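{- Let $A$ be an abelian group and let $P,S,T$ be pairwise commuting group endomorphisms of $A$. Let $A_0=\bigcup_{n\ge1}\ker(P^n)$. Assume: (1) $P$ is surjective; (2) $T$ vanishes on $A_0$; (3) there is $N$ such that $A_0\cap\ker(S)\subseteq A_0\cap \ker(P^N)$. Then for every $a\in A$ with $a\in\ker(S)$ and $P(a)\in\ker(T)$, we have $a\in\ker(T)$. -}

module Defs where

open import Level using (Level)
open import Data.Nat using (ℕ; zero; suc)
open import Data.Product using (∃)
open import Algebra.Bundles using (AbelianGroup)
open import Algebra.Morphism.Structures using (module GroupMorphisms)

module _ {c ℓ : Level} (A : AbelianGroup c ℓ) where
  open AbelianGroup A

  IsEndo : (Carrier → Carrier) → Set (c Level.⊔ ℓ)
  IsEndo f = GroupMorphisms.IsGroupHomomorphism rawGroup rawGroup f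

  iter : (Carrier → Carrier) → ℕ → Carrier → Carrier
  iter f zero x = x
  iter f (suc n) x = f (iter f n x)

  InKer : (Carrier → Carrier) → Carrier → Set ℓ
  InKer f x = f x ≈ ε

  InA₀ : (Carrier → Carrier) → Carrier → Set ℓ
  InA₀ P x = ∃ λ (n : ℕ) → InKer (iter P (suc n)) x

  Commute : (Carrier → Carrier) → (Carrier → Carrier) → Set (c Level.⊔ ℓ)
  Commute f g = ∀ x → f (g x) ≈ g (f x)

  Surj : (Carrier → Carrier) → Set (c Level.⊔ ℓ)
  Surj f = ∀ y → ∃ λ x → f x ≈ y

-- Let a ∈ ker S with P a ∈ ker T, and let N bound the P-torsion of
-- A₀ ∩ ker S.  Since P is surjective so is P^N; write a = P^N a' and put
-- e = T a'.  Because P and T commute, P^N e = T a, hence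
-- P^(N+1) e = T (P a) = 0 and e ∈ A₀.  Likewise P^N (S a') = S a = 0, so
-- S a' ∈ A₀ and T kills it; as S and T commute, S e = T (S a') = 0.
-- Thus e ∈ A₀ ∩ ker S, so P^N e = 0 by the hypothesis on N, i.e. T a = 0.
module Submission where

open import Defs
open import Level using (Level)
open import Data.Nat using (ℕ; zero; suc)
open import Data.Product using (∃; _×_; _,_; proj₂)
open import Algebra.Bundles using (AbelianGroup)
open import Algebra.Morphism.Structures using (module GroupMorphisms)
open GroupMorphisms.IsGroupHomomorphism using (⟦⟧-cong; ε-homo)

module Iterates {c ℓ : Level} (A : AbelianGroup c ℓ) where
  open AbelianGroup A

  module _ (f : Carrier → Carrier) (f-cong : ∀ {x y} → x ≈ y → f x ≈ f y) where

    iter-surjective : Surj A f → ∀ n → Surj A (iter A f n)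
    iter-surjective f-surj zero    y = y , refl
    iter-surjective f-surj (suc n) y with f-surj y
    ... | z , fz≈y with iter-surjective f-surj n z
    ... | x , fⁿx≈z = x , trans (f-cong fⁿx≈z) fz≈y

    iter-commute : (g : Carrier → Carrier) → Commute A f g →
                   ∀ n x → g (iter A f n x) ≈ iter A f n (g x)
    iter-commute g f∘g≈g∘f zero    x = refl
    iter-commute g f∘g≈g∘f (suc n) x = begin
      g (f (iter A f n x))   ≈⟨ f∘g≈g∘f (iter A f n x) ⟨
      f (g (iter A f n x))   ≈⟨ f-cong (iter-commute g f∘g≈g∘f n x) ⟩
      f (iter A f n (g x))   ∎
      where open import Relation.Binary.Reasoning.Setoid setoid

    -- If f fixes ε, anything killed by some iterate f^n lies in
    -- A₀ = ⋃_{m ≥ 1} ker f^m (apply f once more to reach an exponent ≥ 1).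
    ker-iter⊆A₀ : f ε ≈ ε → ∀ n x → InKer A (iter A f n) x → InA₀ A f x
    ker-iter⊆A₀ fε≈ε n x fⁿx≈ε = n , trans (f-cong fⁿx≈ε) fε≈ε

lemma7 : {c ℓ : Level} (A : AbelianGroup c ℓ) (P S T : AbelianGroup.Carrier A → AbelianGroup.Carrier A) →
         IsEndo A P → IsEndo A S → IsEndo A T →
         Commute A P S → Commute A P T → Commute A S T →
         Surj A P →
         (∀ x → InA₀ A P x → InKer A T x) →
         (∃ λ (N : ℕ) → ∀ x → InA₀ A P x → InKer A S x → InA₀ A P x × InKer A (iter A P N) x) →
         ∀ a → InKer A S a → InKer A T (P a) → InKer A T a
lemma7 A P S T hP hS hT cPS cPT cST P-surj T-kills-A₀ (N , bound) a Sa≈ε TPa≈ε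
  with Iterates.iter-surjective A P (⟦⟧-cong hP) P-surj N a
... | a' , Pᴺa'≈a = trans (sym Pᴺe≈Ta) (proj₂ (bound e e∈A₀ Se≈ε))
  where
  open AbelianGroup A
  open Iterates A

  e : Carrier
  e = T a'

  -- a = P^N a' and T commutes with P^N
  Pᴺe≈Ta : iter A P N e ≈ T a
  Pᴺe≈Ta = trans (sym (iter-commute P (⟦⟧-cong hP) T cPT N a')) (⟦⟧-cong hT Pᴺa'≈a)

  -- P^(N+1) e = P (T a) = T (P a) = ε
  e∈A₀ : InA₀ A P e
  e∈A₀ = ker-iter⊆A₀ P (⟦⟧-cong hP) (ε-homo hP) (suc N) e
           (trans (⟦⟧-cong hP Pᴺe≈Ta) (trans (cPT a) TPa≈ε))

  -- P^N (S a') = S (P^N a') = S a = ε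
  Sa'∈A₀ : InA₀ A P (S a')
  Sa'∈A₀ = ker-iter⊆A₀ P (⟦⟧-cong hP) (ε-homo hP) N (S a')
             (trans (sym (iter-commute P (⟦⟧-cong hP) S cPS N a')) (trans (⟦⟧-cong hS Pᴺa'≈a) Sa≈ε))

  -- S (T a') = T (S a') = ε since T kills A₀
  Se≈ε : InKer A S e
  Se≈ε = trans (cST a') (T-kills-A₀ (S a') Sa'∈A₀)
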